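{- Let $M$ be a simple matroid on a finite ground set $E$ with closure operator $\operatorname{cl}$ and set of circuits $\mathcal{C}$. Then $M$ has a unique minimal tropical basis if and only if for every $X \subseteq E$, \[ (E \setminus X) \perp \{ C \in \mathcal{C} \mid \operatorname{cl}(C) = C\} \iff \operatorname{cl}(X) = X. \]
   Context: A subset $\mathcal{C}' \subseteq \mathcal{C}$ is a tropical basis of $M$ if for every $X \subseteq E$ with $X \neq \operatorname{cl}(X)$ there exists $C \in \mathcal{C}'$ with $|C \setminus X| = 1$. A tropical basis $\mathcal{C}'$ is minimal if for every $C \in \mathcal{C}'$ the family $\mathcal{C}' \setminus \{C\}$ is not a tropical basis. For a family $\mathcal{D}$ of subsets of $E$ and $A \subseteq E$, $A \perp \mathcal{D}$ means $|A \cap D| \neq 1$ for every $D \in \mathcal{D}$. -}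

module Defs where

open import Data.Nat using (ℕ; _≤_)
open import Data.Bool using (Bool; true; false)
open import Data.Fin using (Fin)
open import Data.Fin.Subset using (Subset; _∈_; _∉_; _⊆_; _∪_; _∩_; ∁; ⁅_⁆; ∣_∣; ⊥)
open import Data.Product using (Σ; ∃; _×_; _,_)
open import Data.Sum using (_⊎_)
open import Relation.Nullary using (¬_)
open import Relation.Binary.PropositionalEquality using (_≡_; _≢_)

record Matroid (n : ℕ) : Set where
  field
    circuit : Subset n → Bool
  IsCircuit : Subset n → Set
  IsCircuit C = circuit C ≡ true
  field
    C1 : ¬ IsCircuit ⊥
    C2 : ∀ C D → IsCircuit C → IsCircuit D → C ⊆ D → C ≡ D
    C3 : ∀ C D (e : Fin n) → IsCircuit C → IsCircuit D → C ≢ D → e ∈ C → e ∈ D →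
         ∃ λ F → IsCircuit F × F ⊆ (C ∪ D) × e ∉ F

module _ {n : ℕ} (M : Matroid n) where
  open Matroid M

  InCl : Subset n → Fin n → Set
  InCl X e = e ∈ X ⊎ (∃ λ C → IsCircuit C × e ∈ C × C ⊆ (X ∪ ⁅ e ⁆))

  IsClosed : Subset n → Set
  IsClosed X = (∀ e → InCl X e → e ∈ X) × (∀ e → e ∈ X → InCl X e)

  -- simple: no loops and no parallel elements, i.e. every circuit has ≥ 3 elements
  Simple : Set
  Simple = ∀ C → IsCircuit C → 3 ≤ ∣ C ∣

  TropicalBasis : (Subset n → Set) → Set
  TropicalBasis F =
    (∀ C → F C → IsCircuit C) ×
    (∀ X → ¬ IsClosed X → ∃ λ C → F C × ∣ C ∩ ∁ X ∣ ≡ 1)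

  MinimalTropicalBasis : (Subset n → Bool) → Set
  MinimalTropicalBasis B =
    TropicalBasis (λ D → B D ≡ true) ×
    (∀ C → B C ≡ true → ¬ TropicalBasis (λ D → B D ≡ true × D ≢ C))

  UniqueMinimalTropicalBasis : Set
  UniqueMinimalTropicalBasis =
    ∃ λ B → MinimalTropicalBasis B ×
      (∀ B' → MinimalTropicalBasis B' → ∀ C → B' C ≡ B C)

  PerpClosedCircuits : Subset n → Set
  PerpClosedCircuits A = ∀ C → IsCircuit C → IsClosed C → ∣ A ∩ C ∣ ≢ 1

{-# OPTIONS --safe #-}

-- Every tropical basis contains every closed circuit C: for e ∈ C the set C − e is not closed,
-- and by closedness of C the only circuit leaving C − e in exactly one element is C itself.
-- The stated condition says precisely that the closed circuits form a tropical basis (its other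
-- half holds for any closed X), and then they are the unique minimal one.
-- Hence the circuits other than C form a tropical basis, which contains a minimal one, so C does
-- not belong to the unique minimal tropical basis; all its members are therefore closed.
module Submission where

open import Defs
open import Data.Nat using (ℕ)
open import Data.Fin.Subset using (Subset; ∁)
open import Function.Bundles using (_⇔_)

open import Data.Bool as Bool using (Bool; true; false; if_then_else_)
open import Data.Bool.Properties using (⇔→≡; T-≡)
open import Data.Fin using (Fin; _≟_)
open import Data.Fin.Properties using (any?; all?)
open import Data.Fin.Subset using (_∈_; _∉_; _⊆_; _∪_; _∩_; ⁅_⁆; ∣_∣; Nonempty; inside; outside)
open import Data.Fin.Subset.Properties
open import Data.List using (List; []; _∷_; map; _++_)
open import Data.List.Membership.Propositional using () renaming (_∈_ to _∈ᴸ_)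
open import Data.List.Membership.Propositional.Properties using (∈-map⁺; ∈-++⁺ˡ; ∈-++⁺ʳ)
open import Data.List.Relation.Unary.Any using (here; there)
open import Data.Nat as ℕ using (_≤_; _<_; s≤s)
open import Data.Nat.Properties using (<-irrefl)
open import Data.Product using (∃; ∃₂; _×_; _,_; proj₁; proj₂; map₁; map₂; uncurry)
open import Data.Sum as Sum using (_⊎_; inj₁; inj₂; [_,_]′)
open import Data.Vec as Vec using ()
open import Data.Vec.Properties using (≡-dec)
open import Function using (_∘_; id)
open import Function.Bundles using (Equivalence; mk⇔)
open import Relation.Nullary using (¬_; Dec; yes; no; does; contradiction)
open import Relation.Nullary.Decidable
  using (¬?; _×-dec_; _⊎-dec_; _→-dec_; decidable-stable; map′; isYes; toWitness; fromWitness)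
open import Relation.Binary.PropositionalEquality using (_≡_; _≢_; refl; sym; trans; cong; subst; subst₂)

module _ {n : ℕ} where

  _≟ₛ_ : (p q : Subset n) → Dec (p ≡ q)
  _≟ₛ_ = ≡-dec Bool._≟_

  ∀-Subset? : ∀ {P : Subset n → Set} → (∀ p → Dec (P p)) → Dec (∀ p → P p)
  ∀-Subset? P? = map′ (λ ¬∃¬P p → decidable-stable (P? p) (λ ¬Pp → ¬∃¬P (p , ¬Pp)))
                      (λ ∀P (p , ¬Pp) → ¬Pp (∀P p))
                      (¬? (anySubset? (¬? ∘ P?)))

  x∈p⇒⁅x⁆⊆p : ∀ {p : Subset n} {x} → x ∈ p → ⁅ x ⁆ ⊆ p
  x∈p⇒⁅x⁆⊆p {p} {x} x∈p y∈⁅x⁆ = subst (_∈ p) (sym (x∈⁅y⁆⇒x≡y x y∈⁅x⁆)) x∈p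

  x∈p∪⁅y⁆⁻ : ∀ {p : Subset n} {x y} → x ∈ p ∪ ⁅ y ⁆ → x ∈ p ⊎ x ≡ y
  x∈p∪⁅y⁆⁻ {p} {y = y} = Sum.map₂ (x∈⁅y⁆⇒x≡y y) ∘ x∈p∪q⁻ p ⁅ y ⁆

  x∈p∪⁅y⁆∧x≢y⇒x∈p : ∀ {p : Subset n} {x y} → x ∈ p ∪ ⁅ y ⁆ → x ≢ y → x ∈ p
  x∈p∪⁅y⁆∧x≢y⇒x∈p x∈ x≢y = [ id , (λ x≡y → contradiction x≡y x≢y) ]′ (x∈p∪⁅y⁆⁻ x∈)

  x∈p∪⁅x⁆ : ∀ {p : Subset n} {x} → x ∈ p ∪ ⁅ x ⁆
  x∈p∪⁅x⁆ {x = x} = x∈p∪q⁺ (inj₂ (x∈⁅x⁆ x))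

  ∪⁅⁆-monoˡ : ∀ {p q : Subset n} {x} → p ⊆ q → p ∪ ⁅ x ⁆ ⊆ q ∪ ⁅ x ⁆
  ∪⁅⁆-monoˡ p⊆q y∈ with x∈p∪⁅y⁆⁻ y∈
  ... | inj₁ y∈p = x∈p∪q⁺ (inj₁ (p⊆q y∈p))
  ... | inj₂ refl = x∈p∪⁅x⁆

  x∈p⇒p∪⁅x⁆⊆p : ∀ {p : Subset n} {x} → x ∈ p → p ∪ ⁅ x ⁆ ⊆ p
  x∈p⇒p∪⁅x⁆⊆p x∈p y∈ with x∈p∪⁅y⁆⁻ y∈
  ... | inj₁ y∈p = y∈p
  ... | inj₂ refl = x∈p

  ∣p∣≡1⇒p≡⁅x⁆ : ∀ {p : Subset n} → ∣ p ∣ ≡ 1 → ∃ λ x → p ≡ ⁅ x ⁆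
  ∣p∣≡1⇒p≡⁅x⁆ {p} ∣p∣≡1 with nonempty? p
  ... | no empty =
    contradiction (trans (sym (∣⊥∣≡0 n)) (subst (λ q → ∣ q ∣ ≡ 1) (Empty-unique empty) ∣p∣≡1)) λ ()
  ... | yes (x , x∈p) = x , ⊆-antisym p⊆⁅x⁆ (x∈p⇒⁅x⁆⊆p x∈p)
    where
    p⊆⁅x⁆ : p ⊆ ⁅ x ⁆
    p⊆⁅x⁆ {y} y∈p = decidable-stable (y ∈? ⁅ x ⁆) λ y∉⁅x⁆ →
      <-irrefl refl (subst₂ _<_ (∣⁅x⁆∣≡1 x) ∣p∣≡1 (p⊂q⇒∣p∣<∣q∣ (x∈p⇒⁅x⁆⊆p x∈p , y , y∈p , y∉⁅x⁆)))

  infix 4 _∖_≡⁅_⁆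

  -- For a circuit p, the first and last components are exactly the witness of InCl q x.
  _∖_≡⁅_⁆ : Subset n → Subset n → Fin n → Set
  p ∖ q ≡⁅ x ⁆ = x ∈ p × x ∉ q × p ⊆ q ∪ ⁅ x ⁆

  ∖≡⁅⁆⇒≢ : ∀ {p q : Subset n} {x} → p ∖ q ≡⁅ x ⁆ → p ≢ q
  ∖≡⁅⁆⇒≢ (x∈p , x∉q , _) refl = x∉q x∈p

  ∖≡⁅⁆⇒∣p∩∁q∣≡1 : ∀ {p q : Subset n} {x} → p ∖ q ≡⁅ x ⁆ → ∣ p ∩ ∁ q ∣ ≡ 1
  ∖≡⁅⁆⇒∣p∩∁q∣≡1 {p} {q} {x} (x∈p , x∉q , p⊆q∪⁅x⁆) =
    trans (cong ∣_∣ (⊆-antisym p∩∁q⊆⁅x⁆ (x∈p⇒⁅x⁆⊆p (x∈p∩q⁺ (x∈p , x∉p⇒x∈∁p x∉q))))) (∣⁅x⁆∣≡1 x)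
    where
    p∩∁q⊆⁅x⁆ : p ∩ ∁ q ⊆ ⁅ x ⁆
    p∩∁q⊆⁅x⁆ y∈ with x∈p∩q⁻ p (∁ q) y∈
    ... | y∈p , y∈∁q with x∈p∪q⁻ q ⁅ x ⁆ (p⊆q∪⁅x⁆ y∈p)
    ...   | inj₁ y∈q = contradiction y∈q (x∈∁p⇒x∉p y∈∁q)
    ...   | inj₂ y∈⁅x⁆ = y∈⁅x⁆

  ∣p∩∁q∣≡1⇒∖≡⁅⁆ : ∀ {p q : Subset n} → ∣ p ∩ ∁ q ∣ ≡ 1 → ∃ λ x → p ∖ q ≡⁅ x ⁆
  ∣p∩∁q∣≡1⇒∖≡⁅⁆ {p} {q} ∣p∩∁q∣≡1 with ∣p∣≡1⇒p≡⁅x⁆ ∣p∩∁q∣≡1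
  ... | x , p∩∁q≡⁅x⁆ = x , proj₁ x∈p∩∁q , x∈∁p⇒x∉p (proj₂ x∈p∩∁q) , p⊆q∪⁅x⁆
    where
    x∈p∩∁q : x ∈ p × x ∈ ∁ q
    x∈p∩∁q = x∈p∩q⁻ p (∁ q) (subst (x ∈_) (sym p∩∁q≡⁅x⁆) (x∈⁅x⁆ x))
    p⊆q∪⁅x⁆ : p ⊆ q ∪ ⁅ x ⁆
    p⊆q∪⁅x⁆ {y} y∈p with y ∈? q
    ... | yes y∈q = x∈p∪q⁺ (inj₁ y∈q)
    ... | no y∉q = x∈p∪q⁺ (inj₂ (subst (y ∈_) p∩∁q≡⁅x⁆ (x∈p∩q⁺ (y∈p , x∉p⇒x∈∁p y∉q))))

  p∖p∩∁⁅x⁆≡⁅x⁆ : ∀ {p : Subset n} {x} → x ∈ p → p ∖ (p ∩ ∁ ⁅ x ⁆) ≡⁅ x ⁆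
  p∖p∩∁⁅x⁆≡⁅x⁆ {p} {x} x∈p = x∈p , x∉p∩∁⁅x⁆ , p⊆p∩∁⁅x⁆∪⁅x⁆
    where
    x∉p∩∁⁅x⁆ : x ∉ p ∩ ∁ ⁅ x ⁆
    x∉p∩∁⁅x⁆ x∈ = x∈∁p⇒x∉p (proj₂ (x∈p∩q⁻ p _ x∈)) (x∈⁅x⁆ x)
    p⊆p∩∁⁅x⁆∪⁅x⁆ : p ⊆ (p ∩ ∁ ⁅ x ⁆) ∪ ⁅ x ⁆
    p⊆p∩∁⁅x⁆∪⁅x⁆ {y} y∈p with y ∈? ⁅ x ⁆
    ... | yes y∈⁅x⁆ = x∈p∪q⁺ (inj₂ y∈⁅x⁆)
    ... | no y∉⁅x⁆ = x∈p∪q⁺ (inj₁ (x∈p∩q⁺ (y∈p , x∉p⇒x∈∁p y∉⁅x⁆)))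

  -- Opaque so that the implicit arguments of without⁻ and without⁺ are inferred by unification.
  opaque
    _without_ : (Subset n → Bool) → Subset n → Subset n → Bool
    (B without C) D = if does (D ≟ₛ C) then false else B D

  opaque
    unfolding _without_

    without⁻ : ∀ {B C D} → (B without C) D ≡ true → B D ≡ true × D ≢ C
    without⁻ {C = C} {D} with D ≟ₛ C
    ... | yes _ = λ ()
    ... | no D≢C = _, D≢C

    without⁺ : ∀ {B C D} → B D ≡ true → D ≢ C → (B without C) D ≡ true
    without⁺ {C = C} {D} BD D≢C with D ≟ₛ C
    ... | yes D≡C = contradiction D≡C D≢C
    ... | no _ = BD

allSubsets : ∀ n → List (Subset n)
allSubsets ℕ.zero = Vec.[] ∷ []
allSubsets (ℕ.suc n) = map (inside Vec.∷_) (allSubsets n) ++ map (outside Vec.∷_) (allSubsets n)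

∈-allSubsets : ∀ {n} (p : Subset n) → p ∈ᴸ allSubsets n
∈-allSubsets Vec.[] = here refl
∈-allSubsets (inside Vec.∷ p) = ∈-++⁺ˡ (∈-map⁺ (inside Vec.∷_) (∈-allSubsets p))
∈-allSubsets {ℕ.suc n} (outside Vec.∷ p) =
  ∈-++⁺ʳ (map (inside Vec.∷_) (allSubsets n)) (∈-map⁺ (outside Vec.∷_) (∈-allSubsets p))

module _ {n : ℕ} (M : Matroid n) where
  open Matroid M

  private variable
    B : Subset n → Bool
    C D F X : Subset n
    e f g : Fin n

  Loopless : Set
  Loopless = ∀ e → ¬ IsCircuit ⁅ e ⁆

  simple⇒loopless : Simple M → Loopless
  simple⇒loopless simple e circ =
    contradiction (subst (3 ≤_) (∣⁅x⁆∣≡1 e) (simple ⁅ e ⁆ circ)) λ { (s≤s ()) }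

  isCircuit? : ∀ C → Dec (IsCircuit C)
  isCircuit? C = circuit C Bool.≟ true

  inCl? : ∀ X e → Dec (InCl M X e)
  inCl? X e = e ∈? X ⊎-dec anySubset? λ C → isCircuit? C ×-dec e ∈? C ×-dec C ⊆? X ∪ ⁅ e ⁆

  isClosed? : ∀ X → Dec (IsClosed M X)
  isClosed? X = map′ (λ cl⊆X → cl⊆X , λ _ → inj₁) proj₁ (all? λ e → inCl? X e →-dec e ∈? X)

  circuit-nonempty : IsCircuit C → Nonempty C
  circuit-nonempty {C} circC =
    decidable-stable (nonempty? C) λ empty → C1 (subst IsCircuit (Empty-unique empty) circC)

  closed⇒¬∖≡⁅⁆ : IsClosed M X → IsCircuit C → ¬ C ∖ X ≡⁅ e ⁆
  closed⇒¬∖≡⁅⁆ {e = e} closed circC (e∈C , e∉X , C⊆X∪⁅e⁆) =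
    e∉X (proj₁ closed e (inj₂ (_ , circC , e∈C , C⊆X∪⁅e⁆)))

  ¬closed⇒∖≡⁅⁆ : ¬ IsClosed M X → ∃₂ λ C e → IsCircuit C × C ∖ X ≡⁅ e ⁆
  ¬closed⇒∖≡⁅⁆ {X} ¬closed with any? (λ e → ¬? (e ∈? X) ×-dec inCl? X e)
  ... | yes (e , e∉X , inj₁ e∈X) = contradiction e∈X e∉X
  ... | yes (e , e∉X , inj₂ (C , circC , e∈C , C⊆X∪⁅e⁆)) = C , e , circC , e∈C , e∉X , C⊆X∪⁅e⁆
  ... | no ¬∃ = contradiction closed ¬closed
    where
    closed : IsClosed M X
    closed = (λ e e∈cl → decidable-stable (e ∈? X) λ e∉X → ¬∃ (e , e∉X , e∈cl)) , λ _ → inj₁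

  closed⇒perp : IsClosed M X → PerpClosedCircuits M (∁ X)
  closed⇒perp {X} closed C circC _ ∣∁X∩C∣≡1 =
    let e , C∖X≡⁅e⁆ = ∣p∩∁q∣≡1⇒∖≡⁅⁆ (trans (cong ∣_∣ (∩-comm C (∁ X))) ∣∁X∩C∣≡1)
    in closed⇒¬∖≡⁅⁆ closed circC C∖X≡⁅e⁆

  TropicalBasisᵇ : (Subset n → Bool) → Set
  TropicalBasisᵇ B = TropicalBasis M (λ C → B C ≡ true)

  tropicalBasisᵇ? : ∀ B → Dec (TropicalBasisᵇ B)
  tropicalBasisᵇ? B =
    ∀-Subset? (λ C → B C Bool.≟ true →-dec isCircuit? C) ×-dec
    ∀-Subset? (λ X → ¬? (isClosed? X) →-dec anySubset? λ C → B C Bool.≟ true ×-dec ∣ C ∩ ∁ X ∣ ℕ.≟ 1)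

  tropicalBasis-mono : ∀ {P Q : Subset n → Set} → (∀ {C} → P C → Q C) → (∀ {C} → Q C → IsCircuit C) →
                       TropicalBasis M P → TropicalBasis M Q
  tropicalBasis-mono P⊆Q Q⊆circuits (_ , hit) = (λ _ → Q⊆circuits) , λ X → map₂ (map₁ P⊆Q) ∘ hit X

  -- A member kept
  -- at some stage stays necessary afterwards, since enlarging a tropical basis by circuits keeps it one.
  prune : List (Subset n) → (Subset n → Bool) → Subset n → Bool
  prune [] B = B
  prune (C ∷ Cs) B with tropicalBasisᵇ? (B without C)
  ... | yes _ = prune Cs (B without C)
  ... | no _ = prune Cs B

  prune⊆ : ∀ Cs → prune Cs B D ≡ true → B D ≡ true
  prune⊆ [] = id
  prune⊆ {B = B} (C ∷ Cs) with tropicalBasisᵇ? (B without C)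
  ... | yes _ = proj₁ ∘ without⁻ ∘ prune⊆ Cs
  ... | no _ = prune⊆ Cs

  prune-basis : ∀ Cs → TropicalBasisᵇ B → TropicalBasisᵇ (prune Cs B)
  prune-basis [] = id
  prune-basis {B = B} (C ∷ Cs) basis with tropicalBasisᵇ? (B without C)
  ... | yes basis' = prune-basis Cs basis'
  ... | no _ = prune-basis Cs basis

  prune-minimal : ∀ Cs → TropicalBasisᵇ B → C ∈ᴸ Cs → prune Cs B C ≡ true →
                  ¬ TropicalBasis M (λ D → prune Cs B D ≡ true × D ≢ C)
  prune-minimal {B = B} (C ∷ Cs) basis (here refl) prunedC basis' with tropicalBasisᵇ? (B without C)
  ... | yes _ = proj₂ (without⁻ (prune⊆ Cs prunedC)) refl
  ... | no ¬basis = ¬basis (tropicalBasis-mono (λ (prunedD , D≢C) → without⁺ (prune⊆ Cs prunedD) D≢C)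
                                                 (λ {D} → proj₁ basis D ∘ proj₁ ∘ without⁻) basis')
  prune-minimal {B = B} (C' ∷ Cs) basis (there C∈Cs) with tropicalBasisᵇ? (B without C')
  ... | yes basis' = prune-minimal Cs basis' C∈Cs
  ... | no _ = prune-minimal Cs basis C∈Cs

  minimal-⊆ : TropicalBasisᵇ B → ∃ λ B' → MinimalTropicalBasis M B' × (∀ C → B' C ≡ true → B C ≡ true)
  minimal-⊆ {B} basis =
    prune (allSubsets n) B ,
    (prune-basis (allSubsets n) basis , λ C → prune-minimal (allSubsets n) basis (∈-allSubsets C)) ,
    λ C → prune⊆ (allSubsets n)

  closedCircuit-∖≡⁅⁆⇒≡ : IsCircuit C → IsClosed M C → IsCircuit D → D ∖ (C ∩ ∁ ⁅ e ⁆) ≡⁅ f ⁆ → D ≡ C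
  closedCircuit-∖≡⁅⁆⇒≡ {C} {D} {e} {f} circC closedC circD (f∈D , _ , D⊆) =
    C2 D C circD circC (⊆-trans D⊆C∪⁅f⁆ (x∈p⇒p∪⁅x⁆⊆p f∈C))
    where
    D⊆C∪⁅f⁆ : D ⊆ C ∪ ⁅ f ⁆
    D⊆C∪⁅f⁆ = ⊆-trans D⊆ (∪⁅⁆-monoˡ (p∩q⊆p C (∁ ⁅ e ⁆)))
    f∈C : f ∈ C
    f∈C = proj₁ closedC f (inj₂ (D , circD , f∈D , D⊆C∪⁅f⁆))

  closedCircuit∈tropicalBasis : ∀ {P} → TropicalBasis M P → IsCircuit C → IsClosed M C → P C
  closedCircuit∈tropicalBasis {C} {P} (circuits , hit) circC closedC with circuit-nonempty circC
  ... | e , e∈C with hit (C ∩ ∁ ⁅ e ⁆) (λ closed → closed⇒¬∖≡⁅⁆ closed circC (p∖p∩∁⁅x⁆≡⁅x⁆ e∈C))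
  ...   | D , PD , ∣D∖[C-e]∣≡1 =
    subst P (closedCircuit-∖≡⁅⁆⇒≡ circC closedC (circuits D PD) (proj₂ (∣p∩∁q∣≡1⇒∖≡⁅⁆ ∣D∖[C-e]∣≡1))) PD

  closedCircuit : Subset n → Bool
  closedCircuit C = isYes (isCircuit? C ×-dec isClosed? C)

  closedCircuit⁻ : closedCircuit C ≡ true → IsCircuit C × IsClosed M C
  closedCircuit⁻ {C} = toWitness {a? = isCircuit? C ×-dec isClosed? C} ∘ Equivalence.from T-≡

  closedCircuit⁺ : IsCircuit C → IsClosed M C → closedCircuit C ≡ true
  closedCircuit⁺ {C} circC closedC =
    Equivalence.to T-≡ (fromWitness {a? = isCircuit? C ×-dec isClosed? C} (circC , closedC))

  closedCircuits⊆tropicalBasis : ∀ {P} → TropicalBasis M P → closedCircuit C ≡ true → P C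
  closedCircuits⊆tropicalBasis basis = uncurry (closedCircuit∈tropicalBasis basis) ∘ closedCircuit⁻

  closedCircuits-tropicalBasis : (∀ X → PerpClosedCircuits M (∁ X) → IsClosed M X) →
                                 TropicalBasisᵇ closedCircuit
  closedCircuits-tropicalBasis perp⇒closed = (λ _ → proj₁ ∘ closedCircuit⁻) , hit
    where
    hit : ∀ X → ¬ IsClosed M X → ∃ λ C → closedCircuit C ≡ true × ∣ C ∩ ∁ X ∣ ≡ 1
    hit X ¬closed =
      decidable-stable (anySubset? λ C → closedCircuit C Bool.≟ true ×-dec ∣ C ∩ ∁ X ∣ ℕ.≟ 1) λ ¬hit →
      ¬closed (perp⇒closed X λ C circC closedC ∣∁X∩C∣≡1 →
        ¬hit (C , closedCircuit⁺ circC closedC , trans (cong ∣_∣ (∩-comm C (∁ X))) ∣∁X∩C∣≡1))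

  closedCircuits-uniqueMinimal : TropicalBasisᵇ closedCircuit → UniqueMinimalTropicalBasis M
  closedCircuits-uniqueMinimal basis = closedCircuit , (basis , minimal) , unique
    where
    minimal : ∀ C → closedCircuit C ≡ true → ¬ TropicalBasis M (λ D → closedCircuit D ≡ true × D ≢ C)
    minimal C closedC basis' = proj₂ (closedCircuits⊆tropicalBasis basis' closedC) refl
    unique : ∀ B → MinimalTropicalBasis M B → ∀ C → B C ≡ closedCircuit C
    unique B (basisB , minimalB) C = ⇔→≡ (mk⇔ B⊆closed (closedCircuits⊆tropicalBasis basisB))
      where
      B⊆closed : B C ≡ true → closedCircuit C ≡ true
      B⊆closed BC = decidable-stable (closedCircuit C Bool.≟ true) λ ¬closedC →
        minimalB C BC (tropicalBasis-mono
          (λ closedD → closedCircuits⊆tropicalBasis basisB closedD , λ { refl → ¬closedC closedD })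
          (λ {D} → proj₁ basisB D ∘ proj₁)
          basis)

  ⊆∪⁅⁆⇒≡ : IsCircuit C → IsCircuit D → D ⊆ C ∪ ⁅ f ⁆ → f ∉ D → D ≡ C
  ⊆∪⁅⁆⇒≡ circC circD D⊆C∪⁅f⁆ f∉D = C2 _ _ circD circC λ x∈D →
    x∈p∪⁅y⁆∧x≢y⇒x∈p (D⊆C∪⁅f⁆ x∈D) λ { refl → f∉D x∈D }

  ∖≡⁅⁆-avoiding : IsCircuit C → IsCircuit D → D ∖ C ≡⁅ f ⁆ → g ∈ C → g ∈ D →
                  ∃ λ F → IsCircuit F × F ∖ C ≡⁅ f ⁆ × g ∉ F
  ∖≡⁅⁆-avoiding {C} {D} {f} {g} circC circD D∖C@(_ , f∉C , D⊆C∪⁅f⁆) g∈C g∈D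
    with C3 C D g circC circD (∖≡⁅⁆⇒≢ D∖C ∘ sym) g∈C g∈D
  ... | F , circF , F⊆C∪D , g∉F = F , circF , (f∈F , f∉C , F⊆C∪⁅f⁆) , g∉F
    where
    F⊆C∪⁅f⁆ : F ⊆ C ∪ ⁅ f ⁆
    F⊆C∪⁅f⁆ x∈F = [ (λ x∈C → x∈p∪q⁺ (inj₁ x∈C)) , D⊆C∪⁅f⁆ ]′ (x∈p∪q⁻ C D (F⊆C∪D x∈F))
    f∈F : f ∈ F
    f∈F = decidable-stable (f ∈? F) λ f∉F → g∉F (subst (g ∈_) (sym (⊆∪⁅⁆⇒≡ circC circF F⊆C∪⁅f⁆ f∉F)) g∈C)

  ∃-other-element : Loopless → IsCircuit D → f ∈ D → ∃ λ g → g ∈ D × g ≢ f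
  ∃-other-element {D} {f} loopless circD f∈D with any? (λ g → g ∈? D ×-dec ¬? (g ≟ f))
  ... | yes other = other
  ... | no ¬other = contradiction (subst IsCircuit D≡⁅f⁆ circD) (loopless f)
    where
    D≡⁅f⁆ : D ≡ ⁅ f ⁆
    D≡⁅f⁆ = ⊆-antisym
      (λ {g} g∈D → Equivalence.from x∈⁅y⁆⇔x≡y (decidable-stable (g ≟ f) λ g≢f → ¬other (g , g∈D , g≢f)))
      (x∈p⇒⁅x⁆⊆p f∈D)

  -- Eliminating f between D and F gives a circuit inside C, hence C itself.
  ∖≡⁅⁆-cover : IsCircuit C → IsCircuit D → IsCircuit F → D ≢ F → D ∖ C ≡⁅ f ⁆ → F ∖ C ≡⁅ f ⁆ →
               e ∈ C → e ∈ D ⊎ e ∈ F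
  ∖≡⁅⁆-cover {C} {D} {F} {f} {e} circC circD circF D≢F (f∈D , _ , D⊆C∪⁅f⁆) (f∈F , _ , F⊆C∪⁅f⁆) e∈C
    with C3 D F f circD circF D≢F f∈D f∈F
  ... | G , circG , G⊆D∪F , f∉G = x∈p∪q⁻ D F (G⊆D∪F (subst (e ∈_) (sym G≡C) e∈C))
    where
    G≡C : G ≡ C
    G≡C = ⊆∪⁅⁆⇒≡ circC circG (λ x∈G → [ D⊆C∪⁅f⁆ , F⊆C∪⁅f⁆ ]′ (x∈p∪q⁻ D F (G⊆D∪F x∈G))) f∉G

  ∖≡⁅⁆-through : Loopless → IsCircuit C → IsCircuit D → D ∖ C ≡⁅ f ⁆ → e ∈ C →
                 ∃ λ E → IsCircuit E × E ∖ C ≡⁅ f ⁆ × e ∈ E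
  ∖≡⁅⁆-through {C} {D} {f} {e} loopless circC circD D∖C@(f∈D , _ , D⊆C∪⁅f⁆) e∈C with e ∈? D
  ... | yes e∈D = D , circD , D∖C , e∈D
  ... | no e∉D with ∃-other-element loopless circD f∈D
  ...   | g , g∈D , g≢f with ∖≡⁅⁆-avoiding circC circD D∖C (x∈p∪⁅y⁆∧x≢y⇒x∈p (D⊆C∪⁅f⁆ g∈D) g≢f) g∈D
  ...     | F , circF , F∖C , g∉F =
    F , circF , F∖C , [ (λ e∈D → contradiction e∈D e∉D) , id ]′
                        (∖≡⁅⁆-cover circC circD circF (λ { refl → g∉F g∈D }) D∖C F∖C e∈C)

  -- Take E ∋ e, f inside C ∪ f. If f ∈ X, then E leaves X only at e; otherwise eliminating e
  -- between C and E yields a circuit leaving X only at f.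
  ∖≡⁅⁆-another : Loopless → IsCircuit C → IsCircuit D → D ∖ C ≡⁅ f ⁆ → C ∖ X ≡⁅ e ⁆ →
                 ∃₂ λ E h → IsCircuit E × E ≢ C × E ∖ X ≡⁅ h ⁆
  ∖≡⁅⁆-another {C} {f = f} {X} {e} loopless circC circD D∖C (e∈C , e∉X , C⊆X∪⁅e⁆)
    with ∖≡⁅⁆-through loopless circC circD D∖C e∈C
  ... | E , circE , E∖C@(_ , _ , E⊆C∪⁅f⁆) , e∈E with f ∈? X
  ...   | yes f∈X = E , e , circE , ∖≡⁅⁆⇒≢ E∖C , e∈E , e∉X , E⊆X∪⁅e⁆
    where
    E⊆X∪⁅e⁆ : E ⊆ X ∪ ⁅ e ⁆
    E⊆X∪⁅e⁆ x∈E with x∈p∪⁅y⁆⁻ (E⊆C∪⁅f⁆ x∈E)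
    ... | inj₁ x∈C = C⊆X∪⁅e⁆ x∈C
    ... | inj₂ refl = x∈p∪q⁺ (inj₁ f∈X)
  ...   | no f∉X with ∖≡⁅⁆-avoiding circC circE E∖C e∈C e∈E
  ...     | F , circF , F∖C@(f∈F , _ , F⊆C∪⁅f⁆) , e∉F =
    F , f , circF , ∖≡⁅⁆⇒≢ F∖C , f∈F , f∉X , F⊆X∪⁅f⁆
    where
    F⊆X∪⁅f⁆ : F ⊆ X ∪ ⁅ f ⁆
    F⊆X∪⁅f⁆ x∈F with x∈p∪⁅y⁆⁻ (F⊆C∪⁅f⁆ x∈F)
    ... | inj₂ refl = x∈p∪⁅x⁆
    ... | inj₁ x∈C with x∈p∪⁅y⁆⁻ (C⊆X∪⁅e⁆ x∈C)
    ...   | inj₁ x∈X = x∈p∪q⁺ (inj₁ x∈X)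
    ...   | inj₂ refl = contradiction x∈F e∉F

  nonclosed-redundant : Loopless → IsCircuit C → ¬ IsClosed M C → TropicalBasisᵇ (circuit without C)
  nonclosed-redundant {C} loopless circC ¬closedC = (λ _ → proj₁ ∘ without⁻) , hit
    where
    hit : ∀ X → ¬ IsClosed M X → ∃ λ E → (circuit without C) E ≡ true × ∣ E ∩ ∁ X ∣ ≡ 1
    hit X ¬closedX with ¬closed⇒∖≡⁅⁆ ¬closedX
    ... | E , _ , circE , E∖X with E ≟ₛ C
    ...   | no E≢C = E , without⁺ circE E≢C , ∖≡⁅⁆⇒∣p∩∁q∣≡1 E∖X
    ...   | yes refl with ¬closed⇒∖≡⁅⁆ ¬closedC
    ...     | D , _ , circD , D∖C with ∖≡⁅⁆-another loopless circC circD D∖C E∖X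
    ...       | E' , _ , circE' , E'≢C , E'∖X = E' , without⁺ circE' E'≢C , ∖≡⁅⁆⇒∣p∩∁q∣≡1 E'∖X

  uniqueMinimal⇒closed : Loopless → MinimalTropicalBasis M B →
                         (∀ B' → MinimalTropicalBasis M B' → ∀ C → B' C ≡ B C) → B C ≡ true → IsClosed M C
  uniqueMinimal⇒closed {C = C} loopless ((circuits , _) , _) unique BC =
    decidable-stable (isClosed? C) λ ¬closed →
    let B' , minimalB' , B'⊆ = minimal-⊆ (nonclosed-redundant loopless (circuits C BC) ¬closed)
    in proj₂ (without⁻ (B'⊆ C (trans (unique B' minimalB' C) BC))) refl

  uniqueMinimal⇒perp⇒closed : Loopless → UniqueMinimalTropicalBasis M →
                              PerpClosedCircuits M (∁ X) → IsClosed M X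
  uniqueMinimal⇒perp⇒closed {X} loopless (B , minimalB@((circuits , hit) , _) , unique) perp =
    decidable-stable (isClosed? X) λ ¬closed →
      let C , BC , ∣C∩∁X∣≡1 = hit X ¬closed
      in perp C (circuits C BC) (uniqueMinimal⇒closed loopless minimalB unique BC)
              (trans (cong ∣_∣ (∩-comm (∁ X) C)) ∣C∩∁X∣≡1)

theorem4 : ∀ {n : ℕ} (M : Matroid n) → Simple M →
    (UniqueMinimalTropicalBasis M ⇔
      (∀ (X : Subset n) → (PerpClosedCircuits M (∁ X) ⇔ IsClosed M X)))
theorem4 M simple = mk⇔
  (λ unique X → mk⇔ (uniqueMinimal⇒perp⇒closed M (simple⇒loopless M simple) unique) (closed⇒perp M))
  (λ perp⇔closed →
     closedCircuits-uniqueMinimal M (closedCircuits-tropicalBasis M (Equivalence.to ∘ perp⇔closed)))
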